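{- Let $G=(V,E)$ be an undirected graph with positive edge weights and $T\subseteq V$ a terminal set. For any supreme set $X=\mu(R)$, $X$ is the earliest $R$-$(T\setminus R)$ min cut.
   Context: For $X\subseteq V$, $d(X)$ is the total weight of edges with exactly one endpoint in $X$. A Steiner cut is a set $X\subseteq V$ with $X\cap T\neq\emptyset$ and $T\not\subseteq X$. A Steiner cut $X$ is extreme if every Steiner cut $Y\subsetneq X$ satisfies $d(Y)>d(X)$. For $R\subseteq T$, if some extreme set $X$ has $X\cap T=R$, the supreme set $\mu(R)$ is the union of all extreme sets $X$ with $X\cap T=R$; otherwise $\mu(R)$ is undefined. For disjoint nonempty $A,B\subseteq V$, an $A$-$B$ min cut is a set $S$ with $A\subseteq S\subseteq V\setminus B$ minimizing $d(S)$; the earliest $A$-$B$ min cut is the (unique) inclusion-wise minimal such $S$.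
   Formalization: The edge weights are positive rational numbers. -}

module Defs where

open import Data.Nat using (ℕ)
open import Data.Fin using (Fin)
open import Data.Fin.Subset using (Subset; _∈_; _∉_; _⊆_; _⊂_; _∩_; _─_; Nonempty; ⊥)
open import Data.Fin.Subset using () renaming (_∈_ to _∈ₛ_)
open import Data.Bool using (Bool; true; false; _xor_)
open import Data.Vec using (lookup)
open import Data.List using (List; []; _∷_)
open import Data.List.Membership.Propositional using () renaming (_∈_ to _∈ₗ_)
open import Data.List.Relation.Unary.All using (All)
open import Data.Product using (_×_; Σ; ∃; _,_)
open import Data.Rational using (ℚ; 0ℚ; _+_; _<_; _≤_; _>_)
open import Relation.Nullary using (¬_)
open import Relation.Binary.PropositionalEquality using (_≡_)

-- An undirected weighted (multi)graph on vertex set Fin n: a list of edges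
-- {u , v} with weight w; all weights are required to be positive.
record Edge (n : ℕ) : Set where
  constructor edge
  field
    u : Fin n
    v : Fin n
    w : ℚ
open Edge public

Graph : ℕ → Set
Graph n = List (Edge n)

PositiveWeights : ∀ {n} → Graph n → Set
PositiveWeights G = All (λ e → w e > 0ℚ) G

d : ∀ {n} → Graph n → Subset n → ℚ
d [] X = 0ℚ
d (e ∷ G) X with lookup X (u e) xor lookup X (v e)
... | true  = w e + d G X
... | false = d G X

SteinerCut : ∀ {n} → Subset n → Subset n → Set
SteinerCut T X = Nonempty (X ∩ T) × ¬ (T ⊆ X)

Extreme : ∀ {n} → Graph n → Subset n → Subset n → Set
Extreme G T X = SteinerCut T X × (∀ Y → Y ⊂ X → SteinerCut T Y → d G Y > d G X)

-- IsSupreme G T R X : μ(R) is defined (some extreme set X' has X' ∩ T = R)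
-- and X = μ(R), i.e. X is the union of all extreme sets X' with X' ∩ T = R.
IsSupreme : ∀ {n} → Graph n → Subset n → Subset n → Subset n → Set
IsSupreme {n} G T R X =
  (∃ λ X' → Extreme G T X' × X' ∩ T ≡ R) ×
  (∀ (x : Fin n) → (x ∈ X → ∃ λ X' → Extreme G T X' × X' ∩ T ≡ R × x ∈ X')
                 × ((∃ λ X' → Extreme G T X' × X' ∩ T ≡ R × x ∈ X') → x ∈ X))

Separates : ∀ {n} → Subset n → Subset n → Subset n → Set
Separates A B S = A ⊆ S × (S ∩ B ≡ ⊥)

IsMinCut : ∀ {n} → Graph n → Subset n → Subset n → Subset n → Set
IsMinCut G A B S = Separates A B S × (∀ S' → Separates A B S' → d G S ≤ d G S')

IsEarliestMinCut : ∀ {n} → Graph n → Subset n → Subset n → Subset n → Set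
IsEarliestMinCut G A B S = IsMinCut G A B S × (∀ S' → IsMinCut G A B S' → S ⊆ S')

{-# OPTIONS --safe #-}
-- The cut function d is submodular. Uncrossing an extreme set X with trace R
-- against an R-(T ─ R) min cut S shows X ⊆ S: otherwise X ∩ S is a smaller
-- Steiner cut, hence heavier than X, which makes X ∪ S a separating set lighter
-- than S. So μ(R) lies inside every min cut. Conversely, a min cut S of least
-- cardinality is extreme with trace R: a Steiner cut Y ⊊ S containing an extreme
-- X with trace R still separates and is heavier by the choice of S; otherwise
-- uncrossing Y with X gives d(S) ≤ d(X ∪ Y) < d(Y). Hence S ⊆ μ(R) ⊆ S.
module Submission where

open import Defs
open import Data.Nat using (ℕ)
open import Data.Fin.Subset using (Subset; _⊆_; _─_)

open import Algebra.Bundles using (CommutativeMonoid)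
open import Data.Bool using (Bool; true; false; _xor_; _∧_; _∨_; if_then_else_)
import Data.Bool as Bool
open import Data.Fin.Properties using (¬∀⟶∃¬)
open import Data.Fin.Subset using (_∈_; _∉_; _∩_; _∪_; _⊂_; Nonempty; ⊥; ∣_∣; inside; outside)
open import Data.Fin.Subset.Properties
  using (_∈?_; _⊆?_; x∈p∩q⁺; x∈p∩q⁻; x∈p∪q⁺; x∈p∪q⁻; p∩q⊆p; p∩q⊆q; ∩-comm; ⊆-trans; ⊆-antisym;
         Empty-unique; ∉⊥; x∈p∧x∉q⇒x∈p─q; p─q⊆p; p⊂q⇒∣p∣<∣q∣)
open import Data.Nat using (zero; suc) renaming (_≤_ to _≤ℕ_)
import Data.Nat.Properties as ℕ
open import Data.List using ([]; _∷_)
open import Data.List.Relation.Unary.All as All using (All; []; _∷_)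
open import Data.Product using (∃; _×_; _,_; proj₁; proj₂)
open import Data.Rational using (ℚ; 0ℚ; _+_; _≤_; _<_)
import Data.Rational.Properties as ℚ
open import Data.Sum using (_⊎_; inj₁; inj₂; [_,_]′)
open import Data.Vec using ([]; _∷_; lookup; here; there)
open import Data.Vec.Properties using (lookup-zipWith; ≡-dec)
open import Function using (_∘_)
open import Relation.Binary.Bundles using (DecTotalOrder)
open import Relation.Nullary using (¬_; yes; no; contradiction)
open import Relation.Nullary.Decidable using (_×-dec_; _→-dec_; decidable-stable)
open import Relation.Binary.PropositionalEquality using (_≡_; refl; sym; trans; cong₂; subst)
open import Relation.Unary using (Decidable)

open import Algebra.Properties.CommutativeSemigroup
  (CommutativeMonoid.commutativeSemigroup ℚ.+-0-commutativeMonoid) using (interchange)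

x∈p─q⇒x∉q : ∀ {n} (p q : Subset n) {x} → x ∈ p ─ q → x ∉ q
x∈p─q⇒x∉q (inside  ∷ p) (inside ∷ q) () here
x∈p─q⇒x∉q (outside ∷ p) (inside ∷ q) () here
x∈p─q⇒x∉q (_ ∷ p) (_ ∷ q) (there x∈p─q) (there x∈q) = x∈p─q⇒x∉q p q x∈p─q x∈q

module _ {n : ℕ} where

  p∩q⊂p : ∀ {p q : Subset n} → ¬ p ⊆ q → p ∩ q ⊂ p
  p∩q⊂p {p} {q} p⊈q with ¬∀⟶∃¬ n (λ x → x ∈ p → x ∈ q) (λ x → x ∈? p →-dec x ∈? q) (λ p⊆q → p⊈q (p⊆q _))
  ... | x , x∈p⇏x∈q with x ∈? p
  ...   | yes x∈p = p∩q⊆p p q , x , x∈p , λ x∈p∩q → x∈p⇏x∈q λ _ → p∩q⊆q p q x∈p∩q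
  ...   | no x∉p  = contradiction (λ x∈p → contradiction x∈p x∉p) x∈p⇏x∈q

  ∩≡⊥⁺ : ∀ {p q : Subset n} → (∀ {x} → x ∈ p → x ∉ q) → p ∩ q ≡ ⊥
  ∩≡⊥⁺ {p} {q} p∩q∌ = Empty-unique λ (x , x∈p∩q) →
    let x∈p , x∈q = x∈p∩q⁻ p q x∈p∩q in p∩q∌ x∈p x∈q

  p∩q≡r⇒r⊆q : ∀ {p q r : Subset n} → p ∩ q ≡ r → r ⊆ q
  p∩q≡r⇒r⊆q {p} {q} p∩q≡r x∈r = p∩q⊆q p q (subst (_ ∈_) (sym p∩q≡r) x∈r)

  ∩≡⊥⁻ : ∀ {p q : Subset n} → p ∩ q ≡ ⊥ → ∀ {x} → x ∈ p → x ∉ q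
  ∩≡⊥⁻ p∩q≡⊥ x∈p x∈q = ∉⊥ (subst (_ ∈_) p∩q≡⊥ (x∈p∩q⁺ (x∈p , x∈q)))

module _ {c ℓ₁ ℓ₂} (O : DecTotalOrder c ℓ₁ ℓ₂) where
  open DecTotalOrder O using (Carrier; total) renaming (_≤_ to _≼_; refl to ≼-refl; trans to ≼-trans)

  Minimiser : ∀ {n} → (Subset n → Set) → (Subset n → Carrier) → Set _
  Minimiser P f = ∃ λ S → P S × ∀ S′ → P S′ → f S ≼ f S′

  minimiser? : ∀ {n} {P : Subset n → Set} → Decidable P → (f : Subset n → Carrier) →
               (∀ S → ¬ P S) ⊎ Minimiser P f
  minimiser? {zero} P? f with P? []
  ... | yes p = inj₂ ([] , p , λ { [] _ → ≼-refl })
  ... | no ¬p = inj₁ λ { [] → ¬p }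
  minimiser? {suc n} P? f
    with minimiser? (P? ∘ (inside ∷_)) (f ∘ (inside ∷_)) | minimiser? (P? ∘ (outside ∷_)) (f ∘ (outside ∷_))
  ... | inj₁ ¬Pᵢ | inj₁ ¬Pₒ = inj₁ λ { (true ∷ S) → ¬Pᵢ S ; (false ∷ S) → ¬Pₒ S }
  ... | inj₂ (Sᵢ , pᵢ , minᵢ) | inj₁ ¬Pₒ =
    inj₂ (inside ∷ Sᵢ , pᵢ , λ { (true ∷ S) → minᵢ S ; (false ∷ S) p → contradiction p (¬Pₒ S) })
  ... | inj₁ ¬Pᵢ | inj₂ (Sₒ , pₒ , minₒ) =
    inj₂ (outside ∷ Sₒ , pₒ , λ { (true ∷ S) p → contradiction p (¬Pᵢ S) ; (false ∷ S) → minₒ S })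
  ... | inj₂ (Sᵢ , pᵢ , minᵢ) | inj₂ (Sₒ , pₒ , minₒ) with total (f (inside ∷ Sᵢ)) (f (outside ∷ Sₒ))
  ...   | inj₁ fᵢ≼fₒ = inj₂ (inside ∷ Sᵢ , pᵢ ,
            λ { (true ∷ S) → minᵢ S ; (false ∷ S) p → ≼-trans fᵢ≼fₒ (minₒ S p) })
  ...   | inj₂ fₒ≼fᵢ = inj₂ (outside ∷ Sₒ , pₒ ,
            λ { (true ∷ S) p → ≼-trans fₒ≼fᵢ (minᵢ S p) ; (false ∷ S) → minₒ S })

  minimiser : ∀ {n} {P : Subset n → Set} → Decidable P → (f : Subset n → Carrier) →
              ∃ P → Minimiser P f
  minimiser P? f (S , p) with minimiser? P? f
  ... | inj₁ ¬P = contradiction p (¬P S)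
  ... | inj₂ min = min

NonNegativeWeights : ∀ {n} → Graph n → Set
NonNegativeWeights = All (λ e → 0ℚ ≤ w e)

crosses : ∀ {n} → Subset n → Edge n → Bool
crosses X e = lookup X (u e) xor lookup X (v e)

crossingWeight : ∀ {n} → Subset n → Edge n → ℚ
crossingWeight X e = if crosses X e then w e else 0ℚ

d-∷ : ∀ {n} (e : Edge n) (G : Graph n) X → d (e ∷ G) X ≡ crossingWeight X e + d G X
d-∷ e G X with crosses X e
... | true  = refl
... | false = sym (ℚ.+-identityˡ (d G X))

if-xor-submodular : ∀ {x} → 0ℚ ≤ x → ∀ a₁ a₂ c₁ c₂ →
  (if (a₁ ∧ c₁) xor (a₂ ∧ c₂) then x else 0ℚ) + (if (a₁ ∨ c₁) xor (a₂ ∨ c₂) then x else 0ℚ)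
    ≤ (if a₁ xor a₂ then x else 0ℚ) + (if c₁ xor c₂ then x else 0ℚ)
if-xor-submodular {x} 0≤x true  true  true  false = ℚ.≤-reflexive (ℚ.+-comm x 0ℚ)
if-xor-submodular {x} 0≤x true  true  false true  = ℚ.≤-reflexive (ℚ.+-comm x 0ℚ)
if-xor-submodular {x} 0≤x true  false false false = ℚ.≤-reflexive (ℚ.+-comm 0ℚ x)
if-xor-submodular {x} 0≤x false true  false false = ℚ.≤-reflexive (ℚ.+-comm 0ℚ x)
if-xor-submodular     0≤x true  false false true  = ℚ.+-mono-≤ 0≤x 0≤x
if-xor-submodular     0≤x false true  true  false = ℚ.+-mono-≤ 0≤x 0≤x
if-xor-submodular     0≤x true  true  true  true  = ℚ.≤-refl
if-xor-submodular     0≤x true  true  false false = ℚ.≤-refl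
if-xor-submodular     0≤x true  false true  true  = ℚ.≤-refl
if-xor-submodular     0≤x true  false true  false = ℚ.≤-refl
if-xor-submodular     0≤x false true  true  true  = ℚ.≤-refl
if-xor-submodular     0≤x false true  false true  = ℚ.≤-refl
if-xor-submodular     0≤x false false true  true  = ℚ.≤-refl
if-xor-submodular     0≤x false false true  false = ℚ.≤-refl
if-xor-submodular     0≤x false false false true  = ℚ.≤-refl
if-xor-submodular     0≤x false false false false = ℚ.≤-refl

crossingWeight-submodular : ∀ {n} (e : Edge n) → 0ℚ ≤ w e → ∀ A C →
  crossingWeight (A ∩ C) e + crossingWeight (A ∪ C) e ≤ crossingWeight A e + crossingWeight C e
crossingWeight-submodular e 0≤w A C
  rewrite lookup-zipWith _∧_ (u e) A C | lookup-zipWith _∧_ (v e) A C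
        | lookup-zipWith _∨_ (u e) A C | lookup-zipWith _∨_ (v e) A C
  = if-xor-submodular 0≤w (lookup A (u e)) (lookup A (v e)) (lookup C (u e)) (lookup C (v e))

d-submodular : ∀ {n} (G : Graph n) → NonNegativeWeights G → ∀ A C →
  d G (A ∩ C) + d G (A ∪ C) ≤ d G A + d G C
d-submodular [] [] A C = ℚ.≤-refl
d-submodular (e ∷ G) (0≤w ∷ nonNeg) A C = begin
  d (e ∷ G) (A ∩ C) + d (e ∷ G) (A ∪ C)  ≡⟨ cong₂ _+_ (d-∷ e G (A ∩ C)) (d-∷ e G (A ∪ C)) ⟩
  (c∩ + d G (A ∩ C)) + (c∪ + d G (A ∪ C)) ≡⟨ interchange c∩ (d G (A ∩ C)) c∪ (d G (A ∪ C)) ⟩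
  (c∩ + c∪) + (d G (A ∩ C) + d G (A ∪ C)) ≤⟨ ℚ.+-mono-≤ (crossingWeight-submodular e 0≤w A C)
                                                        (d-submodular G nonNeg A C) ⟩
  (cA + cC) + (d G A + d G C)             ≡⟨ interchange cA cC (d G A) (d G C) ⟩
  (cA + d G A) + (cC + d G C)             ≡⟨ cong₂ _+_ (d-∷ e G A) (d-∷ e G C) ⟨
  d (e ∷ G) A + d (e ∷ G) C               ∎
  where
  open ℚ.≤-Reasoning
  c∩ = crossingWeight (A ∩ C) e
  c∪ = crossingWeight (A ∪ C) e
  cA = crossingWeight A e
  cC = crossingWeight C e

d-uncross : ∀ {n} (G : Graph n) → NonNegativeWeights G → ∀ A B →
  d G A < d G (A ∩ B) → d G (A ∪ B) < d G B
d-uncross G nonNeg A B dA<dA∩B = ℚ.≰⇒> λ dB≤dA∪B →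
  ℚ.<-irrefl refl (ℚ.<-≤-trans (ℚ.+-mono-<-≤ dA<dA∩B dB≤dA∪B) (d-submodular G nonNeg A B))

module _ {n} {T : Subset n} where

  steinerCut-trace : ∀ {X Y} → X ∩ T ≡ Y ∩ T → SteinerCut T X → SteinerCut T Y
  steinerCut-trace {X} {Y} X∩T≡Y∩T (X∩T≢∅ , T⊈X) =
    subst Nonempty X∩T≡Y∩T X∩T≢∅ ,
    λ T⊆Y → T⊈X λ x∈T → p∩q⊆p X T (subst (_ ∈_) (sym X∩T≡Y∩T) (x∈p∩q⁺ (T⊆Y x∈T , x∈T)))

  steinerCut-∩ : ∀ {X Y} → SteinerCut T X → (∀ {x} → x ∈ X → x ∈ T → x ∈ Y) → SteinerCut T (X ∩ Y)
  steinerCut-∩ {X} {Y} ((x , x∈X∩T) , T⊈X) X∩T⊆Y =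
    let x∈X , x∈T = x∈p∩q⁻ X T x∈X∩T in
    (x , x∈p∩q⁺ (x∈p∩q⁺ (x∈X , X∩T⊆Y x∈X x∈T) , x∈T)) ,
    λ T⊆X∩Y → T⊈X (p∩q⊆p X Y ∘ T⊆X∩Y)

module _ {n} {T R : Subset n} where

  Separating : Subset n → Set
  Separating = Separates R (T ─ R)

  MinCut : Graph n → Subset n → Set
  MinCut G = IsMinCut G R (T ─ R)

  separating? : Decidable Separating
  separating? S = (R ⊆? S) ×-dec ≡-dec Bool._≟_ (S ∩ (T ─ R)) ⊥

  separating-trace⊆ : ∀ {S} → Separating S → ∀ {x} → x ∈ S → x ∈ T → x ∈ R
  separating-trace⊆ (_ , S∩[T─R]≡⊥) {x} x∈S x∈T =
    decidable-stable (x ∈? R) λ x∉R → ∩≡⊥⁻ S∩[T─R]≡⊥ x∈S (x∈p∧x∉q⇒x∈p─q x∈T x∉R)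

  separating-trace : R ⊆ T → ∀ {S} → Separating S → S ∩ T ≡ R
  separating-trace R⊆T {S} sep@(R⊆S , _) = ⊆-antisym
    (λ x∈S∩T → let x∈S , x∈T = x∈p∩q⁻ S T x∈S∩T in separating-trace⊆ sep x∈S x∈T)
    (λ x∈R → x∈p∩q⁺ (R⊆S x∈R , R⊆T x∈R))

  trace-separating : ∀ {X} → X ∩ T ≡ R → Separating X
  trace-separating {X} X∩T≡R =
    (λ x∈R → p∩q⊆p X T (subst (_ ∈_) (sym X∩T≡R) x∈R)) ,
    ∩≡⊥⁺ λ x∈X x∈T─R →
      x∈p─q⇒x∉q T R x∈T─R (subst (_ ∈_) X∩T≡R (x∈p∩q⁺ (x∈X , p─q⊆p T R x∈T─R)))

  separating-∪ : ∀ {S S′} → Separating S → S′ ∩ (T ─ R) ≡ ⊥ → Separating (S ∪ S′)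
  separating-∪ {S} {S′} (R⊆S , S∩[T─R]≡⊥) S′∩[T─R]≡⊥ =
    (λ x∈R → x∈p∪q⁺ (inj₁ (R⊆S x∈R))) ,
    ∩≡⊥⁺ λ x∈S∪S′ → [ ∩≡⊥⁻ S∩[T─R]≡⊥ , ∩≡⊥⁻ S′∩[T─R]≡⊥ ]′ (x∈p∪q⁻ S S′ x∈S∪S′)

  ⊆-separating-disjoint : ∀ {Y S} → Y ⊆ S → Separating S → Y ∩ (T ─ R) ≡ ⊥
  ⊆-separating-disjoint Y⊆S (_ , S∩[T─R]≡⊥) = ∩≡⊥⁺ (∩≡⊥⁻ S∩[T─R]≡⊥ ∘ Y⊆S)

  smallestMinCut : ∀ (G : Graph n) {X} → Separating X →
    ∃ λ S → MinCut G S × ∀ S′ → MinCut G S′ → ∣ S ∣ ≤ℕ ∣ S′ ∣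
  smallestMinCut G {X} sepX =
    let S , cheapS , smallest = minimiser ℕ.≤-decTotalOrder cheap? ∣_∣ (S₀ , sep₀ , ℚ.≤-refl)
    in S , cheap⇒minCut cheapS , λ S′ minCutS′ → smallest S′ (minCut⇒cheap minCutS′)
    where
    minCut₀ = minimiser ℚ.≤-decTotalOrder separating? (d G) (X , sepX)
    S₀ = proj₁ minCut₀
    sep₀ = proj₁ (proj₂ minCut₀)
    min₀ = proj₂ (proj₂ minCut₀)

    -- Relative to one minimum cut S₀, being a minimum cut becomes decidable.
    Cheap : Subset n → Set
    Cheap S = Separating S × d G S ≤ d G S₀

    cheap? : Decidable Cheap
    cheap? S = separating? S ×-dec (d G S ℚ.≤? d G S₀)

    cheap⇒minCut : ∀ {S} → Cheap S → MinCut G S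
    cheap⇒minCut (sepS , dS≤dS₀) = sepS , λ S′ sepS′ → ℚ.≤-trans dS≤dS₀ (min₀ S′ sepS′)

    minCut⇒cheap : ∀ {S} → MinCut G S → Cheap S
    minCut⇒cheap (sepS , minS) = sepS , minS S₀ sep₀

  extreme⊆minCut : ∀ {G : Graph n} → NonNegativeWeights G →
    ∀ {X S} → Extreme G T X → X ∩ T ≡ R → MinCut G S → X ⊆ S
  extreme⊆minCut {G} nonNeg {X} {S} (steinerX , smallerCutsHeavier) X∩T≡R (sepS , minS) =
    decidable-stable (X ⊆? S) λ X⊈S →
      ℚ.<-irrefl refl (ℚ.<-≤-trans
        (d-uncross G nonNeg X S (smallerCutsHeavier (X ∩ S) (p∩q⊂p X⊈S) steinerX∩S))
        (minS (X ∪ S) (separating-∪ sepX (proj₂ sepS))))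
    where
    sepX = trace-separating X∩T≡R
    steinerX∩S : SteinerCut T (X ∩ S)
    steinerX∩S = steinerCut-∩ steinerX λ x∈X x∈T → proj₁ sepS (separating-trace⊆ sepX x∈X x∈T)

  smallestMinCut-extreme : ∀ {G : Graph n} → NonNegativeWeights G →
    ∀ {X S} → Extreme G T X → X ∩ T ≡ R →
    MinCut G S → (∀ S′ → MinCut G S′ → ∣ S ∣ ≤ℕ ∣ S′ ∣) → Extreme G T S
  smallestMinCut-extreme {G} nonNeg {X} {S} (steinerX , smallerCutsHeavier) X∩T≡R (sepS , minS) smallest =
    steinerCut-trace (trans X∩T≡R (sym (separating-trace (p∩q≡r⇒r⊆q X∩T≡R) sepS))) steinerX ,
    smallerCutsHeavierThanS
    where
    sepX = trace-separating X∩T≡R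

    smallerCutsHeavierThanS : ∀ Y → Y ⊂ S → SteinerCut T Y → d G S < d G Y
    smallerCutsHeavierThanS Y Y⊂S steinerY with X ⊆? Y
    ... | yes X⊆Y = ℚ.≰⇒> λ dY≤dS →
          ℕ.<⇒≱ (p⊂q⇒∣p∣<∣q∣ Y⊂S) (smallest Y (sepY , λ S′ sepS′ → ℚ.≤-trans dY≤dS (minS S′ sepS′)))
      where
      sepY : Separating Y
      sepY = ⊆-trans (proj₁ sepX) X⊆Y , ⊆-separating-disjoint (proj₁ Y⊂S) sepS
    ... | no X⊈Y = ℚ.≤-<-trans
          (minS (X ∪ Y) (separating-∪ sepX (⊆-separating-disjoint (proj₁ Y⊂S) sepS)))
          (d-uncross G nonNeg X Y (smallerCutsHeavier (X ∩ Y) (p∩q⊂p X⊈Y) steinerX∩Y))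
      where
      steinerX∩Y : SteinerCut T (X ∩ Y)
      steinerX∩Y = subst (SteinerCut T) (∩-comm Y X) (steinerCut-∩ steinerY λ y∈Y y∈T →
        proj₁ sepX (separating-trace⊆ sepS (proj₁ Y⊂S y∈Y) y∈T))

  supreme⊆minCut : ∀ {G : Graph n} → NonNegativeWeights G →
    ∀ {X S} → IsSupreme G T R X → MinCut G S → X ⊆ S
  supreme⊆minCut nonNeg (_ , supreme) minCutS {x} x∈X =
    let X′ , extremeX′ , X′∩T≡R , x∈X′ = proj₁ (supreme x) x∈X
    in extreme⊆minCut nonNeg extremeX′ X′∩T≡R minCutS x∈X′

  extremeMinCut⇒supreme-isEarliestMinCut : ∀ {G : Graph n} → NonNegativeWeights G →
    ∀ {X S} → IsSupreme G T R X → MinCut G S → Extreme G T S → S ∩ T ≡ R →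
    IsEarliestMinCut G R (T ─ R) X
  extremeMinCut⇒supreme-isEarliestMinCut {G} nonNeg {X} {S} sup@(_ , supreme) minCutS extremeS S∩T≡R =
    subst (IsEarliestMinCut G R (T ─ R)) (sym X≡S)
          (minCutS , λ S′ minCutS′ → ⊆-trans S⊆X (supreme⊆minCut nonNeg sup minCutS′))
    where
    S⊆X : S ⊆ X
    S⊆X {x} x∈S = proj₂ (supreme x) (S , extremeS , S∩T≡R , x∈S)

    X≡S : X ≡ S
    X≡S = ⊆-antisym (supreme⊆minCut nonNeg sup minCutS) S⊆X

mainTheorem7 : ∀ {n} (G : Graph n) → PositiveWeights G →
    (T R X : Subset n) → IsSupreme G T R X →
    IsEarliestMinCut G R (T ─ R) X
mainTheorem7 G pos T R X sup@((X₀ , extremeX₀ , X₀∩T≡R) , _) =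
  let nonNeg = All.map ℚ.<⇒≤ pos
      S , minCutS , smallest = smallestMinCut G (trace-separating X₀∩T≡R)
  in extremeMinCut⇒supreme-isEarliestMinCut nonNeg sup minCutS
       (smallestMinCut-extreme nonNeg extremeX₀ X₀∩T≡R minCutS smallest)
       (separating-trace (p∩q≡r⇒r⊆q X₀∩T≡R) (proj₁ minCutS))
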